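{- For the Web graph $\mathbb{W}_{n}$ with $n\ge 4$, $\operatorname{mdim}(\mathbb{W}_{n})\ge n+1$.
   Context: For an integer $n\ge 3$, the Web graph $\mathbb{W}_{n}$ has vertex set $\{p_i,q_i,r_i : 1\le i\le n\}$ and edge set $\{p_iq_i,\ p_ip_{i+1},\ q_iq_{i+1},\ q_ir_i : 1\le i\le n\}$, with indices taken modulo $n$. For a connected graph $H$, $d_H(u,v)$ is the shortest-path distance, and for a vertex $x$ and an edge $e=uv$, $d_H(x,e)=\min\{d_H(x,u),d_H(x,v)\}$. A set $M\subseteq V(H)$ is a mixed metric generator of $H$ if for every two distinct elements $y_1,y_2\in V(H)\cup E(H)$ there is a vertex $z\in M$ with $d_H(z,y_1)\ne d_H(z,y_2)$. The mixed metric dimension $\operatorname{mdim}(H)$ is the minimum cardinality of a mixed metric generator of $H$. -}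

module Defs where

open import Data.Nat using (ℕ; zero; suc; _+_; _≤_; _⊔_; _⊓_)
open import Data.Nat.DivMod using (_%_; m%n<n)
open import Data.Fin using (Fin; toℕ; fromℕ<)
open import Data.Product using (Σ; ∃; _×_; _,_)
open import Data.Sum using (_⊎_; inj₁; inj₂)
open import Data.List using (List; length)
open import Data.List.Membership.Propositional using (_∈_)
open import Data.List.Relation.Unary.Unique.Propositional using (Unique)
open import Relation.Binary.PropositionalEquality using (_≡_; _≢_)

data Walk {V : Set} (Adj : V → V → Set) : V → V → ℕ → Set where
  here : ∀ {u} → Walk Adj u u 0
  step : ∀ {u w v k} → Adj u w → Walk Adj w v k → Walk Adj u v (suc k)

Dist : {V : Set} (Adj : V → V → Set) → V → V → ℕ → Set
Dist Adj u v d = Walk Adj u v d × (∀ k → Walk Adj u v k → d ≤ k)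

data Kind : Set where
  P Q R : Kind

-- vertex (P , i) = p_i, (Q , i) = q_i, (R , i) = r_i   (indices 0..n-1)
Vertex : ℕ → Set
Vertex n = Kind × Fin n

next : ∀ {n} → Fin n → Fin n
next {suc m} i = fromℕ< (m%n<n (suc (toℕ i)) (suc m))

data Edge (n : ℕ) : Set where
  pq pp qq qr : Fin n → Edge n

ends : ∀ {n} → Edge n → Vertex n × Vertex n
ends (pq i) = (P , i) , (Q , i)
ends (pp i) = (P , i) , (P , next i)
ends (qq i) = (Q , i) , (Q , next i)
ends (qr i) = (Q , i) , (R , i)

Adj : ∀ {n} → Vertex n → Vertex n → Set
Adj {n} u v = Σ (Edge n) λ e → (ends e ≡ (u , v)) ⊎ (ends e ≡ (v , u))

VDist : ∀ {n} → Vertex n → Vertex n → ℕ → Set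
VDist = Dist Adj

Element : ℕ → Set
Element n = Vertex n ⊎ Edge n

EDist : ∀ {n} → Vertex n → Element n → ℕ → Set
EDist x (inj₁ v) d = VDist x v d
EDist x (inj₂ e) d with ends e
... | (u , v) = ∃ λ d₁ → ∃ λ d₂ → VDist x u d₁ × VDist x v d₂ × d ≡ d₁ ⊓ d₂

Resolves : ∀ {n} → Vertex n → Element n → Element n → Set
Resolves z y₁ y₂ = ∃ λ d₁ → ∃ λ d₂ → EDist z y₁ d₁ × EDist z y₂ d₂ × d₁ ≢ d₂

MixedMetricGenerator : ∀ {n} → List (Vertex n) → Set
MixedMetricGenerator {n} M =
  ∀ (y₁ y₂ : Element n) → y₁ ≢ y₂ → ∃ λ z → z ∈ M × Resolves z y₁ y₂

-- A pendant vertex r_i and its neighbour q_i are at the same distance from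
-- every vertex other than r_i, so only r_i resolves q_i from the edge q_i r_i;
-- hence all n pendant vertices lie in M. Collapsing each p_j onto q_j shortens
-- no walk, so no q_j or r_j is closer to p_i than to q_i; hence only some p_j
-- resolves q_i from the edge p_i q_i, and M contains one vertex more. The
-- argument needs only n ≥ 1 and not that M is duplicate-free.
module Submission where

open import Defs
open import Data.Nat using (ℕ; _≤_; _+_; suc; z≤n; s≤s; _⊓_)
open import Data.Nat.Properties
  using (≤-trans; ≤-antisym; n≤1+n; m≤n⇒m⊓n≡m; m≥n⇒m⊓n≡n; +-comm; module ≤-Reasoning)
open import Data.List using (List; []; _∷_; length; tabulate)
open import Data.List.Properties using (length-removeAt′; length-tabulate)
open import Data.List.Relation.Unary.Any using (here; there; _─_)
open import Data.List.Relation.Unary.All.Properties using (tabulate⁺)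
open import Data.List.Relation.Unary.AllPairs using (_∷_)
open import Data.List.Relation.Unary.Unique.Propositional using (Unique)
import Data.List.Relation.Unary.Unique.Propositional.Properties as Unique
open import Data.List.Relation.Binary.Subset.Propositional using (_⊆_)
open import Data.List.Membership.Propositional using (_∈_)
open import Data.List.Membership.Propositional.Properties using (∈-tabulate⁻)
open import Data.List.Relation.Unary.All using (lookup)
open import Data.Fin using (Fin)
open import Data.Product using (∃; _×_; _,_; proj₂)
open import Data.Sum using (_⊎_; inj₁; inj₂)
open import Data.Empty using (⊥-elim)
open import Relation.Nullary using (¬_)
open import Relation.Binary.PropositionalEquality
  using (_≡_; _≢_; refl; sym; cong; subst; module ≡-Reasoning)

∈-─ : {A : Set} {x y : A} {ys : List A} (x∈ys : x ∈ ys) →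
      y ∈ ys → y ≢ x → y ∈ (ys ─ x∈ys)
∈-─ (here refl)  (here refl)  y≢x = ⊥-elim (y≢x refl)
∈-─ (here refl)  (there y∈ys) y≢x = y∈ys
∈-─ (there x∈ys) (here refl)  y≢x = here refl
∈-─ (there x∈ys) (there y∈ys) y≢x = there (∈-─ x∈ys y∈ys y≢x)

Unique⇒length≤ : {A : Set} {xs ys : List A} → Unique xs → xs ⊆ ys →
                 length xs ≤ length ys
Unique⇒length≤ {xs = []} _ _ = z≤n
Unique⇒length≤ {xs = x ∷ xs} {ys} (x∉xs ∷ unique) x∷xs⊆ys = begin
  suc (length xs)          ≤⟨ s≤s (Unique⇒length≤ unique xs⊆ys─x) ⟩
  suc (length (ys ─ x∈ys)) ≡⟨ sym (length-removeAt′ ys _) ⟩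
  length ys                ∎
  where
  open ≤-Reasoning
  x∈ys : x ∈ ys
  x∈ys = x∷xs⊆ys (here refl)
  xs⊆ys─x : xs ⊆ (ys ─ x∈ys)
  xs⊆ys─x y∈xs = ∈-─ x∈ys (x∷xs⊆ys (there y∈xs)) (λ y≡x → lookup x∉xs y∈xs (sym y≡x))

dist-unique : {V : Set} {Adj : V → V → Set} {u v : V} {d₁ d₂ : ℕ} →
              Dist Adj u v d₁ → Dist Adj u v d₂ → d₁ ≡ d₂
dist-unique (w₁ , min₁) (w₂ , min₂) = ≤-antisym (min₁ _ w₂) (min₂ _ w₁)

adj-r : ∀ {n} {u : Vertex n} {i} → Adj u (R , i) → u ≡ (Q , i)
adj-r (qr _ , inj₁ refl) = refl
adj-r (qr _ , inj₂ ())
adj-r (pq _ , inj₁ ())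
adj-r (pq _ , inj₂ ())
adj-r (pp _ , inj₁ ())
adj-r (pp _ , inj₂ ())
adj-r (qq _ , inj₁ ())
adj-r (qq _ , inj₂ ())

walk-to-r-via-q : ∀ {n} {u : Vertex n} {i k} →
                  Walk Adj u (R , i) (suc k) → Walk Adj u (Q , i) k
walk-to-r-via-q (step a here) = subst (λ u → Walk Adj u _ 0) (sym (adj-r a)) here
walk-to-r-via-q (step a w@(step _ _)) = step a (walk-to-r-via-q w)

squash : ∀ {n} → Vertex n → Vertex n
squash (P , i) = Q , i
squash v       = v

squash-adj : ∀ {n} {u v : Vertex n} → Adj u v → Adj (squash u) (squash v) ⊎ squash u ≡ squash v
squash-adj (pq _ , inj₁ refl) = inj₂ refl
squash-adj (pq _ , inj₂ refl) = inj₂ refl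
squash-adj (pp i , inj₁ refl) = inj₁ (qq i , inj₁ refl)
squash-adj (pp i , inj₂ refl) = inj₁ (qq i , inj₂ refl)
squash-adj (qq i , inj₁ refl) = inj₁ (qq i , inj₁ refl)
squash-adj (qq i , inj₂ refl) = inj₁ (qq i , inj₂ refl)
squash-adj (qr i , inj₁ refl) = inj₁ (qr i , inj₁ refl)
squash-adj (qr i , inj₂ refl) = inj₁ (qr i , inj₂ refl)

squash-walk : ∀ {n} {u v : Vertex n} {k} → Walk Adj u v k →
              ∃ λ k′ → k′ ≤ k × Walk Adj (squash u) (squash v) k′
squash-walk here = 0 , z≤n , here
squash-walk (step a w) with squash-walk w | squash-adj a
... | k′ , k′≤k , w′ | inj₁ a′  = suc k′ , s≤s k′≤k , step a′ w′
... | k′ , k′≤k , w′ | inj₂ u≡w =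
  k′ , ≤-trans k′≤k (n≤1+n _) , subst (λ x → Walk Adj x _ k′) (sym u≡w) w′

resolves-q-qr⇒≡r : ∀ {n} {z : Vertex n} {i} →
                   Resolves z (inj₁ (Q , i)) (inj₂ (qr i)) → z ≡ (R , i)
resolves-q-qr⇒≡r (_ , _ , _ , (_ , _ , _ , (here , _) , _) , _) = refl
resolves-q-qr⇒≡r (d , de , z⇝q , (d₁ , suc k , z⇝q′ , (w@(step _ _) , _) , de≡) , d≢de) =
  ⊥-elim (d≢de (begin
    d          ≡⟨ dist-unique z⇝q z⇝q′ ⟩
    d₁         ≡⟨ sym (m≤n⇒m⊓n≡m (≤-trans (proj₂ z⇝q′ _ (walk-to-r-via-q w)) (n≤1+n k))) ⟩
    d₁ ⊓ suc k ≡⟨ sym de≡ ⟩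
    de         ∎))
  where open ≡-Reasoning

squash-fixed⇒¬resolves-q-pq : ∀ {n} {z : Vertex n} {i} → squash z ≡ z →
                              ¬ Resolves z (inj₁ (Q , i)) (inj₂ (pq i))
squash-fixed⇒¬resolves-q-pq {i = i} fixed
  (d , de , z⇝q , (d₁ , d₂ , (z⇝p , _) , z⇝q′ , de≡) , d≢de)
  with squash-walk z⇝p
... | k′ , k′≤d₁ , w′ = d≢de (begin
    d       ≡⟨ dist-unique z⇝q z⇝q′ ⟩
    d₂      ≡⟨ sym (m≥n⇒m⊓n≡n (≤-trans (proj₂ z⇝q′ _ z⇝q-walk) k′≤d₁)) ⟩
    d₁ ⊓ d₂ ≡⟨ sym de≡ ⟩
    de      ∎)
  where
  open ≡-Reasoning
  z⇝q-walk : Walk Adj _ (Q , i) k′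
  z⇝q-walk = subst (λ x → Walk Adj x (Q , i) k′) fixed w′

r∈generator : ∀ {n} {M : List (Vertex n)} → MixedMetricGenerator M → ∀ i → (R , i) ∈ M
r∈generator gen i with gen (inj₁ (Q , i)) (inj₂ (qr i)) (λ ())
... | z , z∈M , resolves = subst (_∈ _) (resolves-q-qr⇒≡r resolves) z∈M

p∈generator : ∀ {n} {M : List (Vertex n)} → MixedMetricGenerator M → Fin n →
              ∃ λ j → (P , j) ∈ M
p∈generator gen i with gen (inj₁ (Q , i)) (inj₂ (pq i)) (λ ())
... | (P , j) , z∈M , _        = j , z∈M
... | (Q , _) , _   , resolves = ⊥-elim (squash-fixed⇒¬resolves-q-pq refl resolves)
... | (R , _) , _   , resolves = ⊥-elim (squash-fixed⇒¬resolves-q-pq refl resolves)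

lemma6 : (n : ℕ) → 4 ≤ n → (M : List (Vertex n)) → Unique M →
    MixedMetricGenerator M → n + 1 ≤ length M
lemma6 n@(suc _) _ M _ gen with p∈generator gen Fin.zero
... | j , pⱼ∈M = begin
  n + 1                          ≡⟨ +-comm n 1 ⟩
  suc n                          ≡⟨ cong suc (length-tabulate rᵢ) ⟨
  length ((P , j) ∷ tabulate rᵢ) ≤⟨ Unique⇒length≤ unique ⊆M ⟩
  length M                       ∎
  where
  open ≤-Reasoning
  rᵢ : Fin n → Vertex n
  rᵢ i = R , i
  unique : Unique ((P , j) ∷ tabulate rᵢ)
  unique = tabulate⁺ {f = rᵢ} (λ _ ()) ∷ Unique.tabulate⁺ {f = rᵢ} (cong proj₂)
  ⊆M : (P , j) ∷ tabulate rᵢ ⊆ M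
  ⊆M (here refl) = pⱼ∈M
  ⊆M (there r∈) with ∈-tabulate⁻ {f = rᵢ} r∈
  ... | i , refl = r∈generator gen i
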